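{- Let $G$ be a finite non-abelian group with $\exp(G)=p$ for a prime $p$. Then $\mathcal{P}^{**}(G)$ is a line graph (of some graph).
   Context: For a finite group $G$, the power graph $\mathcal{P}(G)$ is the simple graph with vertex set $G$ in which two distinct vertices $u,v$ are adjacent iff $u^m=v$ or $v^n=u$ for some positive integers $m,n$. The proper power graph $\mathcal{P}^{**}(G)$ is obtained from $\mathcal{P}(G)$ by deleting all dominating vertices (vertices adjacent to all other vertices). $\exp(G)$ is the least common multiple of the orders of elements of $G$. A graph is a line graph if it is isomorphic to $L(\Gamma)$ for some graph $\Gamma$, where $L(\Gamma)$ has the edges of $\Gamma$ as vertices, adjacent iff they share an endpoint. -}

module Defs where

open import Level using (0ℓ)
open import Data.Nat using (ℕ; zero; suc; _≤_; _<_)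
open import Data.Fin using (Fin; toℕ)
open import Data.Product using (Σ; _×_; _,_; ∃)
open import Data.Sum using (_⊎_)
open import Data.Bool using (Bool; T)
open import Relation.Nullary using (¬_)
open import Relation.Binary.PropositionalEquality using (_≡_; _≢_)
open import Algebra.Core using (Op₁; Op₂)
open import Algebra.Structures using (IsGroup)

-- A finite group: carrier Fin n (every finite group is isomorphic to one of
-- this form), with propositional equality.
record FiniteGroup : Set where
  field
    n       : ℕ
    _∙_     : Op₂ (Fin n)
    e       : Fin n
    _⁻¹     : Op₁ (Fin n)
    isGroup : IsGroup _≡_ _∙_ e _⁻¹

module _ (G : FiniteGroup) where
  open FiniteGroup G

  Elt : Set
  Elt = Fin n

  pow : Elt → ℕ → Elt
  pow x zero    = e
  pow x (suc m) = x ∙ pow x m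

  NonAbelian : Set
  NonAbelian = ¬ (∀ x y → x ∙ y ≡ y ∙ x)

  Annihilates : ℕ → Set
  Annihilates m = ∀ x → pow x m ≡ e

  IsOrder : Elt → ℕ → Set
  IsOrder x k = 1 ≤ k × pow x k ≡ e × (∀ j → 1 ≤ j → pow x j ≡ e → k ≤ j)

  -- exp(G) = m : m is the least common multiple of the element orders,
  -- i.e. every order divides m, and m divides every common multiple of the orders.
  -- (Stated via divisibility by orders.)
  open import Data.Nat.Divisibility using (_∣_)
  IsExponent : ℕ → Set
  IsExponent m =
    (∀ x k → IsOrder x k → k ∣ m) ×
    (∀ l → (∀ x k → IsOrder x k → k ∣ l) → m ∣ l)

  PowAdj : Elt → Elt → Set
  PowAdj u v = u ≢ v ×
    ((Σ ℕ λ m → 1 ≤ m × pow u m ≡ v) ⊎ (Σ ℕ λ m → 1 ≤ m × pow v m ≡ u))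

  Dominating : Elt → Set
  Dominating u = ∀ v → v ≢ u → PowAdj u v

-- A finite simple graph Γ on vertex set Fin k, adjacency given by a Bool matrix
-- (only the entries E a b with a < b are used: edges are pairs a < b).
record SimpleGraph : Set where
  field
    k   : ℕ
    adj : Fin k → Fin k → Bool

record Edge (Γ : SimpleGraph) : Set where
  constructor edge
  open SimpleGraph Γ
  field
    src : Fin k
    tgt : Fin k
    .lt  : toℕ src < toℕ tgt
    .isE : T (adj src tgt)

LineAdj : (Γ : SimpleGraph) → Edge Γ → Edge Γ → Set
LineAdj Γ e₁ e₂ = e₁ ≢ e₂ ×
  (src e₁ ≡ src e₂ ⊎ src e₁ ≡ tgt e₂ ⊎ tgt e₁ ≡ src e₂ ⊎ tgt e₁ ≡ tgt e₂)
  where open Edge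

-- P**(G) is isomorphic to L(Γ): a bijection between the non-dominating
-- elements of G and the edges of Γ preserving and reflecting adjacency.
record ProperPowerGraph≅LineGraph (G : FiniteGroup) (Γ : SimpleGraph) : Set where
  field
    to       : (x : Elt G) → ¬ Dominating G x → Edge Γ
    from     : Edge Γ → Elt G
    from-ok  : ∀ ε → ¬ Dominating G (from ε)
    to-from  : ∀ ε (p : ¬ Dominating G (from ε)) → to (from ε) p ≡ ε
    from-to  : ∀ x (p : ¬ Dominating G x) → from (to x p) ≡ x
    adj-iff₁ : ∀ x y (p : ¬ Dominating G x) (q : ¬ Dominating G y) →
               PowAdj G x y → LineAdj Γ (to x p) (to y q)
    adj-iff₂ : ∀ x y (p : ¬ Dominating G x) (q : ¬ Dominating G y) →
               LineAdj Γ (to x p) (to y q) → PowAdj G x y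

-- P**(G) is a line graph (of some finite simple graph; isolated vertices of
-- Γ play no role, so finiteness of Γ is no restriction).
ProperPowerGraphIsLineGraph : FiniteGroup → Set
ProperPowerGraphIsLineGraph G = Σ SimpleGraph λ Γ → ProperPowerGraph≅LineGraph G Γ

-- In a group of prime exponent p every element x ≠ e generates a subgroup ⟨x⟩ of
-- order p, and any non-identity element of ⟨x⟩ generates it again (Bézout).
-- Hence two non-identity elements are adjacent in the power graph iff they
-- generate the same subgroup, and since a non-abelian group is not cyclic, e is
-- the only dominating vertex.  So P**(G) is a disjoint union of cliques ⟨x⟩ ∖ {e},
-- which is the line graph of a disjoint union of stars: one star per subgroup,
-- centred at a chosen generator, with the elements of ⟨x⟩ ∖ {e} as its leaves.

module Submission where

open import Defs
open import Data.Nat using (ℕ)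
open import Data.Nat.Primality using (Prime)

open import Level using (Level)
open import Algebra.Bundles using (Group)
open import Data.Bool using (Bool; false; T)
open import Data.Fin as Fin using (Fin; toℕ; fromℕ<; splitAt; _↑ˡ_; _↑ʳ_)
open import Data.Fin.Properties as Finₚ
  using (all?; any?; pigeonhole; toℕ-injective; toℕ-inject; toℕ-fromℕ<; toℕ<n;
         splitAt-↑ˡ; splitAt-↑ʳ; splitAt⁻¹-↑ˡ; splitAt⁻¹-↑ʳ; ↑ˡ-injective; ↑ʳ-injective;
         toℕ-↑ˡ; toℕ-↑ʳ; ¬∀⟶∃¬-smallest)
open import Data.Nat using (zero; suc; _+_; _*_; _∸_; _≤_; _<_; s≤s; z≤n)
open import Data.Nat.Properties as ℕₚ using (*-comm; +-comm)
open import Data.Nat.DivMod using (_%_; _/_; m≡m%n+[m/n]*n; m%n<n)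
open import Data.Nat.Divisibility using (divides)
open import Data.Nat.GCD using (module Bézout)
open import Data.Nat.Coprimality using (Coprime; coprime-Bézout)
open import Data.Nat.Primality using (prime⇒irreducible; ¬prime[0])
open import Data.Nat.Tactic.RingSolver using (solve)
open import Data.List using (_∷_; [])
open import Data.Product using (Σ; ∃; ∃₂; _×_; _,_; proj₁; proj₂)
open import Data.Sum using (_⊎_; inj₁; inj₂; [_,_]′)
open import Function using (_∘_; id; _⇔_; mk⇔; Equivalence)
open import Relation.Nullary using (¬_; Dec; yes; no; contradiction)
open import Relation.Nullary.Decidable
  using (⌊_⌋; toWitness; fromWitness; map′; ¬?; _×-dec_; _→-dec_; decidable-stable; recompute; T?)
open import Relation.Unary using (Pred; Decidable; ∁; _≐_)
open import Relation.Binary using (tri<; tri≈; tri>)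
open import Relation.Binary.PropositionalEquality

module _ {n : ℕ} {ℓ : Level} where

  Least : Pred (Fin n) ℓ → Pred (Fin n) ℓ
  Least P i = P i × (∀ j → j Fin.< i → ¬ P j)

  least : {P : Pred (Fin n) ℓ} → Decidable P → ∀ {i} → P i → ∃ (Least P)
  least {P} P? {i} pᵢ with ¬∀⟶∃¬-smallest n (∁ P) (λ j → ¬? (P? j)) (λ ∀¬P → ∀¬P i pᵢ)
  ... | m , ¬¬pₘ , below = m , decidable-stable (P? m) ¬¬pₘ , minimal
    where
    minimal : ∀ j → j Fin.< m → ¬ P j
    minimal j j<m = subst (∁ P) (toℕ-injective (trans (toℕ-inject k) (toℕ-fromℕ< j<m))) (below k)
      where k = fromℕ< j<m

  least? : {P : Pred (Fin n) ℓ} → Decidable P → Decidable (Least P)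
  least? P? i = P? i ×-dec all? (λ j → (j Fin.<? i) →-dec ¬? (P? j))

  least-unique : {P Q : Pred (Fin n) ℓ} → P ≐ Q → ∀ {i j} → Least P i → Least Q j → i ≡ j
  least-unique (P⊆Q , Q⊆P) {i} {j} (pᵢ , minᵢ) (qⱼ , minⱼ) with Finₚ.<-cmp i j
  ... | tri< i<j _ _ = contradiction (P⊆Q pᵢ) (minⱼ i i<j)
  ... | tri≈ _ i≡j _ = i≡j
  ... | tri> _ _ j<i = contradiction (Q⊆P qⱼ) (minᵢ j j<i)

least-positive : ∀ {ℓ} {P : Pred ℕ ℓ} → Decidable P → ∀ {k} → P (suc k) →
                 ∃ λ m → 1 ≤ m × P m × (∀ l → 1 ≤ l → P l → m ≤ l)
least-positive {P = P} P? {k} pₖ₊₁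
  with least (P? ∘ suc ∘ toℕ) (subst (P ∘ suc) (sym (Finₚ.toℕ-fromℕ k)) pₖ₊₁)
... | j , pⱼ₊₁ , minimal = suc (toℕ j) , s≤s z≤n , pⱼ₊₁ , above
  where
  above : ∀ l → 1 ≤ l → P l → suc (toℕ j) ≤ l
  above (suc l) _ pₗ₊₁ = s≤s (ℕₚ.≮⇒≥ l≮j)
    where
    l≮j : ¬ l < toℕ j
    l≮j l<j = minimal i (subst (_< toℕ j) (sym toℕi≡l) l<j) (subst (P ∘ suc) (sym toℕi≡l) pₗ₊₁)
      where
      l<k : l < suc k
      l<k = ℕₚ.<-trans l<j (toℕ<n j)
      i : Fin (suc k)
      i = fromℕ< l<k
      toℕi≡l : toℕ i ≡ l
      toℕi≡l = toℕ-fromℕ< l<k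

-- A disjoint union of cliques is the line graph of a disjoint union of stars

module Stars {n : ℕ} (Centre : Fin n → Fin n → Set) (Centre? : ∀ c x → Dec (Centre c x))
             (centre-unique : ∀ {c c′ x} → Centre c x → Centre c′ x → c ≡ c′) where

  isStarEdge : Fin n ⊎ Fin n → Fin n ⊎ Fin n → Bool
  isStarEdge (inj₁ c) (inj₂ x) = ⌊ Centre? c x ⌋
  isStarEdge _        _        = false

  -- Vertex c ↑ˡ n is the centre c, vertex n ↑ʳ x the leaf x.
  stars : SimpleGraph
  stars = record { k = n + n ; adj = λ a b → isStarEdge (splitAt n a) (splitAt n b) }

  starEdge : ∀ {c x} → Centre c x → Edge stars
  starEdge {c} {x} h = edge (c ↑ˡ n) (n ↑ʳ x) c<x isE
    where
    c<x : toℕ (c ↑ˡ n) < toℕ (n ↑ʳ x)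
    c<x = subst₂ _<_ (sym (toℕ-↑ˡ c n)) (sym (toℕ-↑ʳ n x))
                 (ℕₚ.<-≤-trans (toℕ<n c) (ℕₚ.m≤m+n n (toℕ x)))
    isE : T (isStarEdge (splitAt n (c ↑ˡ n)) (splitAt n (n ↑ʳ x)))
    isE rewrite splitAt-↑ˡ n c n | splitAt-↑ʳ n n x = fromWitness {a? = Centre? c x} h

  leaf : Edge stars → Fin n
  leaf ε = [ id , id ]′ (splitAt n (Edge.tgt ε))

  leaf-starEdge : ∀ {c x} (h : Centre c x) → leaf (starEdge h) ≡ x
  leaf-starEdge {x = x} _ = cong [ id , id ]′ (splitAt-↑ʳ n n x)

  starEdge-≡ : ∀ {c c′ x x′} (h : Centre c x) (h′ : Centre c′ x′) →
               x ≡ x′ → starEdge h ≡ starEdge h′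
  starEdge-≡ h h′ refl with refl ← centre-unique h h′ = refl

  ↑ˡ≢↑ʳ : ∀ {c x : Fin n} → c ↑ˡ n ≢ n ↑ʳ x
  ↑ˡ≢↑ʳ {c} {x} eq
    with () ← trans (sym (splitAt-↑ˡ n c n)) (trans (cong (splitAt n) eq) (splitAt-↑ʳ n n x))

  edge⇒starEdge : (ε : Edge stars) → ∃₂ λ c x → Σ (Centre c x) λ h → starEdge h ≡ ε
  edge⇒starEdge (edge a b _ isE) with decode a b (recompute (T? _) isE)
    where
    decode : ∀ a b → T (isStarEdge (splitAt n a) (splitAt n b)) →
             ∃₂ λ c x → Centre c x × c ↑ˡ n ≡ a × n ↑ʳ x ≡ b
    decode a b t with splitAt n a in eqa | splitAt n b in eqb
    ... | inj₁ c | inj₂ x =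
      c , x , toWitness {a? = Centre? c x} t , splitAt⁻¹-↑ˡ eqa , splitAt⁻¹-↑ʳ eqb
  ... | c , x , h , refl , refl = c , x , h , refl

  starEdge-leaf : ∀ ε {c} (h : Centre c (leaf ε)) → starEdge h ≡ ε
  starEdge-leaf ε h with edge⇒starEdge ε
  ... | _ , _ , h′ , refl = starEdge-≡ h h′ (leaf-starEdge h′)

  leaf-centre : ∀ ε → ∃ λ c → Centre c (leaf ε)
  leaf-centre ε with edge⇒starEdge ε
  ... | c , _ , h , refl = c , subst (Centre c) (sym (leaf-starEdge h)) h

  lineAdj⇔ : ∀ {c c′ x x′} (h : Centre c x) (h′ : Centre c′ x′) →
             LineAdj stars (starEdge h) (starEdge h′) ⇔ (x ≢ x′ × c ≡ c′)
  lineAdj⇔ {c} {c′} {x} {x′} h h′ = mk⇔ to from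
    where
    to : LineAdj stars (starEdge h) (starEdge h′) → x ≢ x′ × c ≡ c′
    to (ε≢ε′ , inj₁ c≡c′)               = ε≢ε′ ∘ starEdge-≡ h h′ , ↑ˡ-injective n c c′ c≡c′
    to (_    , inj₂ (inj₁ c≡x′))        = contradiction c≡x′ ↑ˡ≢↑ʳ
    to (_    , inj₂ (inj₂ (inj₁ x≡c′))) = contradiction (sym x≡c′) ↑ˡ≢↑ʳ
    to (ε≢ε′ , inj₂ (inj₂ (inj₂ x≡x′))) =
      contradiction (starEdge-≡ h h′ (↑ʳ-injective n x x′ x≡x′)) ε≢ε′
    from : x ≢ x′ × c ≡ c′ → LineAdj stars (starEdge h) (starEdge h′)
    from (x≢x′ , c≡c′) = (λ ε≡ε′ → x≢x′ (↑ʳ-injective n x x′ (cong Edge.tgt ε≡ε′)))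
                       , inj₁ (cong (_↑ˡ n) c≡c′)

module Powers (G : FiniteGroup) where
  open FiniteGroup G

  group : Group _ _
  group = record { isGroup = isGroup }

  open Group group using (assoc; identityˡ; identityʳ; ∙-congˡ)
  open import Algebra.Properties.Group group using (∙-cancelʳ)

  infix 4 _∈⟨_⟩

  -- In a finite group the positive powers of x already make up ⟨x⟩.
  _∈⟨_⟩ : Elt G → Elt G → Set
  y ∈⟨ x ⟩ = Σ ℕ λ m → 1 ≤ m × pow G x m ≡ y

  pow-+ : ∀ x a b → pow G x (a + b) ≡ pow G x a ∙ pow G x b
  pow-+ x zero    b = sym (identityˡ _)
  pow-+ x (suc a) b = trans (∙-congˡ (pow-+ x a b)) (sym (assoc x _ _))

  pow-* : ∀ x a b → pow G x (a * b) ≡ pow G (pow G x a) b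
  pow-* x a zero    = cong (pow G x) (ℕₚ.*-zeroʳ a)
  pow-* x a (suc b) = begin
    pow G x (a * suc b)                   ≡⟨ cong (pow G x) (ℕₚ.*-suc a b) ⟩
    pow G x (a + a * b)                   ≡⟨ pow-+ x a (a * b) ⟩
    pow G x a ∙ pow G x (a * b)           ≡⟨ ∙-congˡ (pow-* x a b) ⟩
    pow G x a ∙ pow G (pow G x a) b       ∎
    where open ≡-Reasoning

  pow-e : ∀ m → pow G e m ≡ e
  pow-e zero    = refl
  pow-e (suc m) = trans (∙-congˡ (pow-e m)) (identityʳ e)

  ∈⟨⟩-refl : ∀ x → x ∈⟨ x ⟩
  ∈⟨⟩-refl x = 1 , s≤s z≤n , identityʳ x

  ∈⟨⟩-trans : ∀ {x y z} → y ∈⟨ x ⟩ → z ∈⟨ y ⟩ → z ∈⟨ x ⟩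
  ∈⟨⟩-trans {x} (suc a , _ , refl) (suc b , _ , refl) = suc a * suc b , s≤s z≤n , pow-* x (suc a) (suc b)

  cyclic⇒commutative : ∀ {x} → (∀ y → y ∈⟨ x ⟩) → ∀ a b → a ∙ b ≡ b ∙ a
  cyclic⇒commutative {x} ⟨x⟩≡G a b with ⟨x⟩≡G a | ⟨x⟩≡G b
  ... | i , _ , refl | j , _ , refl =
    trans (sym (pow-+ x i j)) (trans (cong (pow G x) (+-comm i j)) (pow-+ x j i))

  e∈⟨_⟩ : ∀ x → e ∈⟨ x ⟩
  e∈⟨ x ⟩ with pigeonhole (ℕₚ.n<1+n n) (λ (i : Fin (suc n)) → pow G x (toℕ i))
  ... | i , j , i<j , xⁱ≡xʲ = toℕ j ∸ toℕ i , ℕₚ.m<n⇒0<n∸m i<j , ∙-cancelʳ _ _ _ xᵈxⁱ≡xⁱ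
    where
    xᵈxⁱ≡xⁱ : pow G x (toℕ j ∸ toℕ i) ∙ pow G x (toℕ i) ≡ e ∙ pow G x (toℕ i)
    xᵈxⁱ≡xⁱ = begin
      pow G x (toℕ j ∸ toℕ i) ∙ pow G x (toℕ i)  ≡⟨ pow-+ x (toℕ j ∸ toℕ i) (toℕ i) ⟨
      pow G x (toℕ j ∸ toℕ i + toℕ i)            ≡⟨ cong (pow G x) (ℕₚ.m∸n+n≡m (ℕₚ.<⇒≤ i<j)) ⟩
      pow G x (toℕ j)                            ≡⟨ xⁱ≡xʲ ⟨
      pow G x (toℕ i)                            ≡⟨ identityˡ _ ⟨
      e ∙ pow G x (toℕ i)                        ∎
      where open ≡-Reasoning

  order : ∀ x → ∃ (IsOrder G x)
  order x with e∈⟨ x ⟩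
  ... | suc k , _ , xᵏ⁺¹≡e = least-positive (λ m → pow G x m Finₚ.≟ e) {k} xᵏ⁺¹≡e

  exponent⇒annihilates : ∀ {m} → IsExponent G m → Annihilates G m
  exponent⇒annihilates {m} (orders∣m , _) x with order x
  ... | k , ord@(_ , xᵏ≡e , _) with orders∣m x k ord
  ... | divides c m≡ck = begin
    pow G x m              ≡⟨ cong (pow G x) (trans m≡ck (*-comm c k)) ⟩
    pow G x (k * c)        ≡⟨ pow-* x k c ⟩
    pow G (pow G x k) c    ≡⟨ cong (λ y → pow G y c) xᵏ≡e ⟩
    pow G e c              ≡⟨ pow-e c ⟩
    e                      ∎
    where open ≡-Reasoning

module Annihilated (G : FiniteGroup) (q : ℕ) (annihilates : Annihilates G (suc q)) where
  open FiniteGroup G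
  open Powers G
  open Group group using (identityʳ; ∙-congˡ)

  N : ℕ
  N = suc q

  pow-multiple : ∀ x s → pow G x (s * N) ≡ e
  pow-multiple x s = begin
    pow G x (s * N)        ≡⟨ cong (pow G x) (*-comm s N) ⟩
    pow G x (N * s)        ≡⟨ pow-* x N s ⟩
    pow G (pow G x N) s    ≡⟨ cong (λ y → pow G y s) (annihilates x) ⟩
    pow G e s              ≡⟨ pow-e s ⟩
    e                      ∎
    where open ≡-Reasoning

  pow-≡ : ∀ x {a b} s t → a + s * N ≡ b + t * N → pow G x a ≡ pow G x b
  pow-≡ x {a} {b} s t eq = begin
    pow G x a                      ≡⟨ identityʳ _ ⟨
    pow G x a ∙ e                  ≡⟨ ∙-congˡ (pow-multiple x s) ⟨
    pow G x a ∙ pow G x (s * N)    ≡⟨ pow-+ x a (s * N) ⟨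
    pow G x (a + s * N)            ≡⟨ cong (pow G x) eq ⟩
    pow G x (b + t * N)            ≡⟨ pow-+ x b (t * N) ⟩
    pow G x b ∙ pow G x (t * N)    ≡⟨ ∙-congˡ (pow-multiple x t) ⟩
    pow G x b ∙ e                  ≡⟨ identityʳ _ ⟩
    pow G x b                      ∎
    where open ≡-Reasoning

  pow-% : ∀ x m → pow G x m ≡ pow G x (m % N)
  pow-% x m = pow-≡ x 0 (m / N) (trans (ℕₚ.+-identityʳ m) (m≡m%n+[m/n]*n m N))

  pow⇒∈⟨⟩ : ∀ x m → pow G x m ∈⟨ x ⟩
  pow⇒∈⟨⟩ x zero    = N , s≤s z≤n , annihilates x
  pow⇒∈⟨⟩ x (suc m) = suc m , s≤s z≤n , refl

  ∈⟨⟩? : ∀ x y → Dec (y ∈⟨ x ⟩)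
  ∈⟨⟩? x y = map′ (λ (j , xʲ≡y) → subst (_∈⟨ x ⟩) xʲ≡y (pow⇒∈⟨⟩ x (toℕ j)))
                  (λ (m , _ , xᵐ≡y) → reduce m , trans (sym (pow-reduce m)) xᵐ≡y)
                  (any? λ j → pow G x (toℕ j) Finₚ.≟ y)
    where
    reduce : ℕ → Fin N
    reduce m = fromℕ< (m%n<n m N)
    pow-reduce : ∀ m → pow G x m ≡ pow G x (toℕ (reduce m))
    pow-reduce m = trans (pow-% x m) (cong (pow G x) (sym (toℕ-fromℕ< (m%n<n m N))))

  e-dominating : Dominating G e
  e-dominating v v≢e = (λ e≡v → v≢e (sym e≡v)) , inj₂ (pow⇒∈⟨⟩ v zero)

  -- Bézout: a v ≡ ±1 (mod N), and −1 ≡ q (mod N) turns the minus case into a positive power.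
  ∈⟨pow⟩ : ∀ x a → Coprime N a → x ∈⟨ pow G x a ⟩
  ∈⟨pow⟩ x a N⊥a with coprime-Bézout N⊥a
  ... | Bézout.-+ u v 1+uN≡va = subst (_∈⟨ pow G x a ⟩) xᵃᵛ≡x (pow⇒∈⟨⟩ (pow G x a) v)
    where
    xᵃᵛ≡x : pow G (pow G x a) v ≡ x
    xᵃᵛ≡x = trans (sym (pow-* x a v))
              (trans (pow-≡ x 0 u (trans (ℕₚ.+-identityʳ _) (trans (*-comm a v) (sym 1+uN≡va))))
                (identityʳ x))
  ... | Bézout.+- u v 1+va≡uN = subst (_∈⟨ pow G x a ⟩) xᵃᵛᵠ≡x (pow⇒∈⟨⟩ (pow G x a) (v * q))
    where
    avq+N≡1+uqN : a * (v * q) + 1 * N ≡ 1 + (u * q) * N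
    avq+N≡1+uqN = begin
      a * (v * q) + 1 * suc q  ≡⟨ solve (a ∷ v ∷ q ∷ []) ⟩
      1 + (1 + v * a) * q      ≡⟨ cong (λ m → 1 + m * q) 1+va≡uN ⟩
      1 + (u * suc q) * q      ≡⟨ solve (u ∷ q ∷ []) ⟩
      1 + (u * q) * suc q      ∎
      where open ≡-Reasoning
    xᵃᵛᵠ≡x : pow G (pow G x a) (v * q) ≡ x
    xᵃᵛᵠ≡x = trans (sym (pow-* x a (v * q))) (trans (pow-≡ x 1 (u * q) avq+N≡1+uqN) (identityʳ x))

module PrimeExponent (G : FiniteGroup) (q : ℕ) (N-prime : Prime (suc q))
                     (annihilates : Annihilates G (suc q)) where
  open FiniteGroup G
  open Powers G
  open Annihilated G q annihilates

  pow≢e⇒coprime : ∀ x a → pow G x a ≢ e → Coprime N a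
  pow≢e⇒coprime x a xᵃ≢e {d} (d∣N , d∣a) with prime⇒irreducible N-prime d∣N
  ... | inj₁ d≡1 = d≡1
  ... | inj₂ refl with d∣a
  ...   | divides c a≡cN = contradiction (trans (cong (pow G x) a≡cN) (pow-multiple x c)) xᵃ≢e

  ∈⟨⟩-sym : ∀ {x y} → y ∈⟨ x ⟩ → y ≢ e → x ∈⟨ y ⟩
  ∈⟨⟩-sym {x} (a , _ , refl) xᵃ≢e = ∈⟨pow⟩ x a (pow≢e⇒coprime x a xᵃ≢e)

  ⟨_⟩∖e : Elt G → Pred (Elt G) _
  ⟨ x ⟩∖e y = y ≢ e × y ∈⟨ x ⟩

  ⟨⟩∖e? : ∀ x → Decidable ⟨ x ⟩∖e
  ⟨⟩∖e? x y = ¬? (y Finₚ.≟ e) ×-dec ∈⟨⟩? x y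

  ⟨⟩∖e-≐ : ∀ {x y} → y ∈⟨ x ⟩ → y ≢ e → ⟨ x ⟩∖e ≐ ⟨ y ⟩∖e
  ⟨⟩∖e-≐ y∈⟨x⟩ y≢e = (λ (z≢e , z∈⟨x⟩) → z≢e , ∈⟨⟩-trans (∈⟨⟩-sym y∈⟨x⟩ y≢e) z∈⟨x⟩)
                   , (λ (z≢e , z∈⟨y⟩) → z≢e , ∈⟨⟩-trans y∈⟨x⟩ z∈⟨y⟩)

  -- Any canonical choice of a generator of ⟨x⟩ would do; we take the least one.
  IsCentre : Elt G → Elt G → Set
  IsCentre c x = Least ⟨ x ⟩∖e c

  centre : ∀ {x} → x ≢ e → ∃ λ c → IsCentre c x
  centre {x} x≢e = least (⟨⟩∖e? x) (x≢e , ∈⟨⟩-refl x)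

  centre-unique : ∀ {c c′ x} → IsCentre c x → IsCentre c′ x → c ≡ c′
  centre-unique = least-unique (id , id)

  centre⇒≢e : ∀ {c x} → IsCentre c x → x ≢ e
  centre⇒≢e ((c≢e , m , _ , refl) , _) refl = c≢e (pow-e m)

  powAdj⇔same-centre : ∀ {c c′ x y} → IsCentre c x → IsCentre c′ y →
                       (y ∈⟨ x ⟩ ⊎ x ∈⟨ y ⟩) ⇔ c ≡ c′
  powAdj⇔same-centre {c} {c′} {x} {y} cx@((c≢e , c∈⟨x⟩) , _) c′y@((_ , c′∈⟨y⟩) , _) =
    mk⇔ to from
    where
    to : y ∈⟨ x ⟩ ⊎ x ∈⟨ y ⟩ → c ≡ c′
    to (inj₁ y∈⟨x⟩) = least-unique (⟨⟩∖e-≐ y∈⟨x⟩ (centre⇒≢e c′y)) cx c′y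
    to (inj₂ x∈⟨y⟩) = sym (least-unique (⟨⟩∖e-≐ x∈⟨y⟩ (centre⇒≢e cx)) c′y cx)
    from : c ≡ c′ → y ∈⟨ x ⟩ ⊎ x ∈⟨ y ⟩
    from c≡c′ = inj₁ (∈⟨⟩-trans c∈⟨x⟩ (∈⟨⟩-sym (subst (_∈⟨ y ⟩) (sym c≡c′) c′∈⟨y⟩) c≢e))

  dominating⇒≡e : NonAbelian G → ∀ {x} → Dominating G x → x ≡ e
  dominating⇒≡e nonAbelian {x} dom =
    decidable-stable (x Finₚ.≟ e) (λ x≢e → nonAbelian (cyclic⇒commutative (generates x≢e)))
    where
    generates : x ≢ e → ∀ y → y ∈⟨ x ⟩
    generates x≢e y with y Finₚ.≟ x
    ... | yes refl = ∈⟨⟩-refl x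
    ... | no  y≢x  = [ id , (λ x∈⟨y⟩ → ∈⟨⟩-sym x∈⟨y⟩ x≢e) ]′ (proj₂ (dom y y≢x))

  nonDominating⇔≢e : NonAbelian G → ∀ x → (¬ Dominating G x) ⇔ x ≢ e
  nonDominating⇔≢e nonAbelian x =
    mk⇔ (λ ¬dom x≡e → ¬dom (subst (Dominating G) (sym x≡e) e-dominating))
        (λ x≢e dom → x≢e (dominating⇒≡e nonAbelian dom))

mainTheorem4 : (G : FiniteGroup) → NonAbelian G → (p : ℕ) → Prime p →
               IsExponent G p → ProperPowerGraphIsLineGraph G
mainTheorem4 G nonAbelian zero    p-prime _   = contradiction p-prime ¬prime[0]
mainTheorem4 G nonAbelian (suc q) p-prime exp = stars , record
  { to       = λ x ¬dom → starEdge (centreOf ¬dom)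
  ; from     = leaf
  ; from-ok  = λ ε →
      from (nonDominating⇔≢e nonAbelian (leaf ε)) (centre⇒≢e (proj₂ (leaf-centre ε)))
  ; to-from  = λ ε ¬dom → starEdge-leaf ε (centreOf ¬dom)
  ; from-to  = λ x ¬dom → leaf-starEdge (centreOf ¬dom)
  ; adj-iff₁ = λ x y ¬domx ¬domy (x≢y , powAdj) →
      from (lineAdj⇔ (centreOf ¬domx) (centreOf ¬domy))
           (x≢y , to (powAdj⇔same-centre (centreOf ¬domx) (centreOf ¬domy)) powAdj)
  ; adj-iff₂ = λ x y ¬domx ¬domy lineAdj →
      let x≢y , c≡c′ = to (lineAdj⇔ (centreOf ¬domx) (centreOf ¬domy)) lineAdj
      in x≢y , from (powAdj⇔same-centre (centreOf ¬domx) (centreOf ¬domy)) c≡c′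
  }
  where
  open Equivalence
  open PrimeExponent G q p-prime (Powers.exponent⇒annihilates G exp)
  open Stars IsCentre (λ c x → least? (⟨⟩∖e? x) c) centre-unique

  centreOf : ∀ {x} (¬dom : ¬ Dominating G x) →
             IsCentre (proj₁ (centre (to (nonDominating⇔≢e nonAbelian x) ¬dom))) x
  centreOf {x} ¬dom = proj₂ (centre (to (nonDominating⇔≢e nonAbelian x) ¬dom))
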